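{- For every (finite, simple) graph $G$ without isolated vertices, $\chi'_{CF}(G)\leq 3\lceil\log_2\chi(G)\rceil+1$, where $\chi(G)$ is the chromatic number of $G$.
   Context: For a graph $G=(V,E)$ and a vertex $v$, let $E_G(v)$ be the set of edges incident to $v$, and for an edge $uv$ let $E_G[uv]=E_G(u)\cup E_G(v)$ (the closed neighbourhood of $uv$, which contains $uv$ itself). An edge colouring $c$ of $G$ (not necessarily proper) is conflict-free if for every edge $e$ of $G$ some colour occurs on exactly one edge of $E_G[e]$. The conflict-free chromatic index $\chi'_{CF}(G)$ is the least number of colours admitting a conflict-free edge colouring of $G$. -}

module Defs where

open import Data.Nat using (ℕ; _≤_)
open import Data.Fin using (Fin)
open import Data.Bool using (Bool; T)
open import Data.Product using (Σ; ∃; _×_; _,_)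
open import Data.Sum using (_⊎_)
open import Data.Empty using (⊥)
open import Relation.Binary.PropositionalEquality using (_≡_; _≢_)

record SimpleGraph (n : ℕ) : Set where
  field
    adj     : Fin n → Fin n → Bool
    sym     : ∀ x y → T (adj x y) → T (adj y x)
    irrefl  : ∀ x → T (adj x x) → ⊥

open SimpleGraph public

module _ {n : ℕ} (G : SimpleGraph n) where

  Adj : Fin n → Fin n → Set
  Adj x y = T (adj G x y)

  NoIsolatedVertices : Set
  NoIsolatedVertices = ∀ v → ∃ λ u → Adj v u

  ProperColouring : (k : ℕ) → (Fin n → Fin k) → Set
  ProperColouring k f = ∀ x y → Adj x y → f x ≢ f y

  Colourable : ℕ → Set
  Colourable k = Σ (Fin n → Fin k) (ProperColouring k)

  IsChromaticNumber : ℕ → Set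
  IsChromaticNumber k = Colourable k × (∀ j → Colourable j → k ≤ j)

  -- An edge colouring: a colour for each ordered pair, required to be
  -- symmetric on edges (so it is a colouring of the unordered edges uv);
  -- values on non-edges are irrelevant.
  EdgeColouring : ℕ → Set
  EdgeColouring k =
    Σ (Fin n → Fin n → Fin k) λ c → ∀ x y → Adj x y → c x y ≡ c y x

  SameEdge : Fin n → Fin n → Fin n → Fin n → Set
  SameEdge x y x' y' = (x ≡ x' × y ≡ y') ⊎ (x ≡ y' × y ≡ x')

  IncidentTo : Fin n → Fin n → Fin n → Set
  IncidentTo x y w = (x ≡ w) ⊎ (y ≡ w)

  InClosedNbhd : Fin n → Fin n → Fin n → Fin n → Set
  InClosedNbhd u v x y = Adj x y × (IncidentTo x y u ⊎ IncidentTo x y v)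

  UniqueColourAt : {k : ℕ} → (Fin n → Fin n → Fin k) → Fin n → Fin n → Fin k → Set
  UniqueColourAt c u v i =
    Σ (Fin n) λ x → Σ (Fin n) λ y →
      InClosedNbhd u v x y × c x y ≡ i ×
      (∀ x' y' → InClosedNbhd u v x' y' → c x' y' ≡ i → SameEdge x y x' y')

  ConflictFree : (k : ℕ) → EdgeColouring k → Set
  ConflictFree k (c , _) =
    ∀ u v → Adj u v → Σ (Fin k) λ i → UniqueColourAt c u v i

  CFEdgeColourable : ℕ → Set
  CFEdgeColourable k = Σ (EdgeColouring k) (ConflictFree k)

{-# OPTIONS --safe #-}
-- Fix a proper colouring with 2^k colours, k = ⌈log₂ χ⌉, and give each edge xy the level ℓ of
-- the first binary digit in which the colours of x and y differ. The edges of level ℓ form a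
-- bipartite graph, split by digit ℓ. Colouring an edge by the pair of its level and a colour
-- inside its layer, only edges of the same level can share a colour, so it suffices to colour
-- every bipartite layer conflict-free with 3 colours.
--
-- In a bipartite graph with sides A and B, take a minimal set D dominating the non-isolated
-- vertices of A: each b ∈ D has a private neighbour s(b) ∈ A, and each non-isolated a ∈ A has a
-- neighbour p(a) ∈ D. Colour the edges s(b)b with 2, the remaining edges ap(a) with 1 and all
-- others 0. In E[ab], colour 2 occurs only on s(b)b when b ∈ D; otherwise the colour of
-- ap(a) occurs only there, because every edge a′b′ of nonzero colour has b′ = p(a′) ∈ D.
module Submission where

open import Defs renaming (sym to adj-sym)
open import Data.Nat using (ℕ; zero; suc; _+_; _*_; _^_; _≤_; _<_; z≤n; s≤s; ⌈_/2⌉; ⌊_/2⌋)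
open import Data.Nat.Properties
  using (+-monoʳ-≤; +-monoˡ-≤; +-mono-≤; +-suc; +-identityʳ; ⌊n/2⌋≤⌈n/2⌉; ⌊n/2⌋+⌈n/2⌉≡n; ⌈n/2⌉<n; module ≤-Reasoning)
open import Data.Nat.Induction using (<-wellFounded)
open import Data.Nat.Logarithm using (⌈log₂_⌉)
open import Data.Nat.Logarithm.Core using (⌈log2⌉)
open import Data.Fin using (Fin; zero; suc; _≟_; combine; _↑ˡ_; _↑ʳ_; funToFin; finToFun; inject≤)
open import Data.Fin.Patterns using (0F; 1F; 2F)
open import Data.Fin.Properties
  using (any?; all?; ¬∀⟶∃¬; ↑ˡ-injective; combine-injective; funToFin-finToFin; inject≤-injective)
open import Data.Fin.Subset using (Subset; _∈_; _∉_; _-_; ⊤; ∣_∣)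
open import Data.Fin.Subset.Properties using (_∈?_; ∈⊤; x∈p∧x≢y⇒x∈p-y; x∈p⇒∣p-x∣<∣p∣)
open import Data.Maybe using (Maybe; just; nothing; maybe′)
import Data.Maybe as Maybe
open import Data.Maybe.Properties using (≡-dec)
open import Data.Bool using (_∧_)
open import Data.Bool.Properties using (T-∧)
open import Data.Product using (Σ; ∃; _×_; _,_; proj₁; proj₂; map₂)
open import Data.Sum using (_⊎_; inj₁; inj₂; swap)
import Data.Sum as Sum
open import Function using (_∘_)
open import Function.Bundles using (Equivalence)
open import Induction.WellFounded using (Acc; acc)
open import Relation.Binary.Definitions using (DecidableEquality)
open import Relation.Binary.PropositionalEquality
open import Relation.Nullary using (Dec; yes; no; ¬_; contradiction)
open import Relation.Nullary.Decidable using (_×-dec_; _→-dec_; T?; isYes; toWitness; fromWitness)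

n≤2^⌈log2⌉n : ∀ n (rec : Acc _<_ n) → n ≤ 2 ^ ⌈log2⌉ n rec
n≤2^⌈log2⌉n 0 _ = z≤n
n≤2^⌈log2⌉n 1 _ = s≤s z≤n
n≤2^⌈log2⌉n (suc (suc n)) (acc rs) = begin
  2 + n                   ≡⟨ cong (2 +_) (⌊n/2⌋+⌈n/2⌉≡n n) ⟨
  2 + (⌊ n /2⌋ + ⌈ n /2⌉) ≤⟨ +-monoʳ-≤ 2 (+-monoˡ-≤ ⌈ n /2⌉ (⌊n/2⌋≤⌈n/2⌉ n)) ⟩
  2 + (⌈ n /2⌉ + ⌈ n /2⌉) ≡⟨ cong suc (+-suc ⌈ n /2⌉ ⌈ n /2⌉) ⟨
  h + h                   ≤⟨ +-mono-≤ ih ih ⟩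
  2 ^ e + 2 ^ e           ≡⟨ cong (2 ^ e +_) (+-identityʳ (2 ^ e)) ⟨
  2 ^ suc e               ∎
  where
  open ≤-Reasoning
  h : ℕ
  h = suc ⌈ n /2⌉
  e : ℕ
  e = ⌈log2⌉ h (rs (⌈n/2⌉<n n))
  ih : h ≤ 2 ^ e
  ih = n≤2^⌈log2⌉n h (rs (⌈n/2⌉<n n))

n≤2^⌈log₂n⌉ : ∀ n → n ≤ 2 ^ ⌈log₂ n ⌉
n≤2^⌈log₂n⌉ n = n≤2^⌈log2⌉n n (<-wellFounded n)

funToFin-cong : ∀ {m n} {f g : Fin m → Fin n} → f ≗ g → funToFin f ≡ funToFin g
funToFin-cong {zero} f≗g = refl
funToFin-cong {suc m} f≗g = cong₂ combine (f≗g zero) (funToFin-cong (f≗g ∘ suc))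

finToFun-injective : ∀ {m n} {i j : Fin (m ^ n)} → finToFun {m} {n} i ≗ finToFun j → i ≡ j
finToFun-injective {m} {n} {i} {j} eq = begin
  i                             ≡⟨ funToFin-finToFin {n} {m} i ⟨
  funToFin (finToFun {m} {n} i) ≡⟨ funToFin-cong eq ⟩
  funToFin (finToFun {m} {n} j) ≡⟨ funToFin-finToFin {n} {m} j ⟩
  j                             ∎
  where open ≡-Reasoning

module _ {a} {A : Set a} (_≟_ : DecidableEquality A) where

  firstDifference : ∀ {k} → (Fin k → A) → (Fin k → A) → Maybe (Fin k)
  firstDifference {zero}  u v = nothing
  firstDifference {suc k} u v with u zero ≟ v zero
  ... | yes _ = Maybe.map suc (firstDifference (u ∘ suc) (v ∘ suc))
  ... | no _  = just zero

  firstDifference-comm : ∀ {k} (u v : Fin k → A) → firstDifference u v ≡ firstDifference v u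
  firstDifference-comm {zero}  u v = refl
  firstDifference-comm {suc k} u v with u zero ≟ v zero | v zero ≟ u zero
  ... | yes _  | yes _  = cong (Maybe.map suc) (firstDifference-comm (u ∘ suc) (v ∘ suc))
  ... | no _   | no _   = refl
  ... | yes eq | no neq = contradiction (sym eq) neq
  ... | no neq | yes eq = contradiction (sym eq) neq

  firstDifference≡just⇒≢ : ∀ {k} (u v : Fin k → A) {i} → firstDifference u v ≡ just i → u i ≢ v i
  firstDifference≡just⇒≢ {suc k} u v eq with u zero ≟ v zero
  firstDifference≡just⇒≢ {suc k} u v eq | no u₀≢v₀ with refl ← eq = u₀≢v₀
  firstDifference≡just⇒≢ {suc k} u v eq | yes _ with firstDifference (u ∘ suc) (v ∘ suc) in eq′
  firstDifference≡just⇒≢ {suc k} u v refl | yes _ | just j = firstDifference≡just⇒≢ (u ∘ suc) (v ∘ suc) eq′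

  firstDifference≡nothing⇒≗ : ∀ {k} (u v : Fin k → A) → firstDifference u v ≡ nothing → u ≗ v
  firstDifference≡nothing⇒≗ {suc k} u v eq i with u zero ≟ v zero
  firstDifference≡nothing⇒≗ {suc k} u v eq zero | yes u₀≡v₀ = u₀≡v₀
  firstDifference≡nothing⇒≗ {suc k} u v eq (suc i) | yes _ with firstDifference (u ∘ suc) (v ∘ suc) in eq′
  ... | nothing = firstDifference≡nothing⇒≗ (u ∘ suc) (v ∘ suc) eq′ i

¬[→→]⇒× : ∀ {P Q R : Set} → Dec P → Dec Q → ¬ (P → Q → R) → P × Q × ¬ R
¬[→→]⇒× (yes p) (yes q) ¬f = p , q , λ r → ¬f λ _ _ → r
¬[→→]⇒× (no ¬p) _       ¬f = contradiction (λ p → contradiction p ¬p) ¬f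
¬[→→]⇒× (yes _) (no ¬q) ¬f = contradiction (λ _ q → contradiction q ¬q) ¬f

module _ {n} {P : Fin n → Set} where

  select : Dec (∃ P) → Fin n → Fin n
  select (yes (x , _)) _ = x
  select (no _)        d = d

  select-sound : (P? : Dec (∃ P)) (d : Fin n) → ∃ P → P (select P? d)
  select-sound (yes (_ , px)) _ _ = px
  select-sound (no ¬∃P)       _ e = contradiction e ¬∃P

module _ {n} (G : SimpleGraph n) where

  Adj? : ∀ x y → Dec (Adj G x y)
  Adj? x y = T? (adj G x y)

  uniqueColourAt-swap : ∀ {k} {c : Fin n → Fin n → Fin k} {u v i} →
    UniqueColourAt G c u v i → UniqueColourAt G c v u i
  uniqueColourAt-swap (x , y , (xy , inc) , cxy , unique) =
    x , y , (xy , swap inc) , cxy , λ x′ y′ (x′y′ , inc′) → unique x′ y′ (x′y′ , swap inc′)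

module Bipartite {n} (H : SimpleGraph n) (side : Fin n → Fin 2)
                 (proper : ProperColouring H 2 side) where

  Left : Fin n → Set
  Left a = side a ≡ zero

  left? : ∀ a → Dec (Left a)
  left? a = side a ≟ zero

  left-nbr-right : ∀ {a b} → Left a → Adj H a b → ¬ Left b
  left-nbr-right a∈L ab b∈L = proper _ _ ab (trans a∈L (sym b∈L))

  right-nbr-left : ∀ {a b} → ¬ Left a → Adj H a b → Left b
  right-nbr-left {a} {b} a∉L ab with side a | side b | proper a b ab
  ... | zero  | _     | _   = contradiction refl a∉L
  ... | suc _ | zero  | _   = refl
  ... | suc zero | suc zero | ≢ = contradiction refl ≢

  Dominates : Subset n → Fin n → Set
  Dominates D a = Left a → (∃ λ b → Adj H a b) → ∃ λ b → b ∈ D × Adj H a b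

  dominates? : ∀ D a → Dec (Dominates D a)
  dominates? D a =
    left? a →-dec (any? (Adj? H a) →-dec any? λ b → (b ∈? D) ×-dec Adj? H a b)

  Dominating : Subset n → Set
  Dominating D = ∀ a → Dominates D a

  dominating? : ∀ D → Dec (Dominating D)
  dominating? D = all? (dominates? D)

  PrivateNeighbour : Subset n → Fin n → Fin n → Set
  PrivateNeighbour D v a = Left a × Adj H a v × (∀ b → b ∈ D → Adj H a b → b ≡ v)

  privateNeighbour? : ∀ D v a → Dec (PrivateNeighbour D v a)
  privateNeighbour? D v a =
    left? a ×-dec Adj? H a v ×-dec all? λ b → (b ∈? D) →-dec (Adj? H a b →-dec (b ≟ v))

  MinimalDominating : Subset n → Set
  MinimalDominating D = Dominating D × (∀ v → v ∈ D → ∃ (PrivateNeighbour D v))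

  privateNeighbour : ∀ {D v} → Dominating D → ¬ Dominating (D - v) → ∃ (PrivateNeighbour D v)
  privateNeighbour {D} {v} D-dom D-v-¬dom
    with a , ¬dom ← ¬∀⟶∃¬ n _ (dominates? (D - v)) D-v-¬dom
    with a∈L , a-nbr , ¬nbr ← ¬[→→]⇒× (left? a) (any? (Adj? H a)) ¬dom
    with b , b∈D , ab ← D-dom a a∈L a-nbr
    = a , a∈L , subst (Adj H a) (only b b∈D ab) ab , only
    where
    only : ∀ b → b ∈ D → Adj H a b → b ≡ v
    only b b∈D ab with b ≟ v
    ... | yes b≡v = b≡v
    ... | no  b≢v = contradiction (b , x∈p∧x≢y⇒x∈p-y b∈D b≢v , ab) ¬nbr

  minimise : ∀ D → Acc _<_ ∣ D ∣ → Dominating D → ∃ MinimalDominating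
  minimise D (acc rs) D-dom with any? (λ v → (v ∈? D) ×-dec dominating? (D - v))
  ... | yes (v , v∈D , D-v-dom) = minimise (D - v) (rs (x∈p⇒∣p-x∣<∣p∣ v∈D)) D-v-dom
  ... | no ¬removable =
    D , D-dom , λ v v∈D → privateNeighbour D-dom λ D-v-dom → ¬removable (v , v∈D , D-v-dom)

  minimalDominating : ∃ MinimalDominating
  minimalDominating = minimise ⊤ (<-wellFounded _) λ _ _ (b , ab) → b , ∈⊤ , ab

  module Colouring (D : Subset n) (D-dom : Dominating D)
                   (D-private : ∀ v → v ∈ D → ∃ (PrivateNeighbour D v)) where

    dominator : Fin n → Fin n
    dominator a = select (any? λ b → (b ∈? D) ×-dec Adj? H a b) a

    dominator-spec : ∀ {a b} → Left a → Adj H a b → dominator a ∈ D × Adj H a (dominator a)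
    dominator-spec {a} {b} a∈L ab =
      select-sound (any? λ b → (b ∈? D) ×-dec Adj? H a b) a (D-dom a a∈L (b , ab))

    privateNbr : Fin n → Fin n
    privateNbr v = select (any? (privateNeighbour? D v)) v

    privateNbr-spec : ∀ {v} → v ∈ D → PrivateNeighbour D v (privateNbr v)
    privateNbr-spec {v} v∈D = select-sound (any? (privateNeighbour? D v)) v (D-private v v∈D)

    tag : Fin n → Fin n → Fin 3
    tag a b with (b ∈? D) ×-dec (privateNbr b ≟ a) | dominator a ≟ b
    ... | yes _ | _     = 2F
    ... | no _  | yes _ = 1F
    ... | no _  | no _  = 0F

    tag≡2⇒private : ∀ {a b} → tag a b ≡ 2F → b ∈ D × privateNbr b ≡ a
    tag≡2⇒private {a} {b} with (b ∈? D) ×-dec (privateNbr b ≟ a) | dominator a ≟ b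
    ... | yes p | _     = λ _ → p
    ... | no _  | yes _ = λ ()
    ... | no _  | no _  = λ ()

    private⇒tag≡2 : ∀ {b} → b ∈ D → tag (privateNbr b) b ≡ 2F
    private⇒tag≡2 {b} b∈D with (b ∈? D) ×-dec (privateNbr b ≟ privateNbr b) | dominator (privateNbr b) ≟ b
    ... | yes _ | _ = refl
    ... | no ¬p | _ = contradiction (b∈D , refl) ¬p

    tag≢0⇒dominator : ∀ {a b} → Left a → Adj H a b → tag a b ≢ 0F → dominator a ≡ b
    tag≢0⇒dominator {a} {b} a∈L ab tag≢0 with (b ∈? D) ×-dec (privateNbr b ≟ a) | dominator a ≟ b
    ... | yes (b∈D , refl) | _ =
      let d∈D , ad = dominator-spec a∈L ab in proj₂ (proj₂ (privateNbr-spec b∈D)) _ d∈D ad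
    ... | no _ | yes e = e
    ... | no _ | no _  = contradiction refl tag≢0

    tag-dominator≢0 : ∀ a → tag a (dominator a) ≢ 0F
    tag-dominator≢0 a with (dominator a ∈? D) ×-dec (privateNbr (dominator a) ≟ a) | dominator a ≟ dominator a
    ... | yes _ | _      = λ ()
    ... | no _  | yes _  = λ ()
    ... | no _  | no ¬refl = contradiction refl ¬refl

    private-edge-unique : ∀ {a b} → Adj H a b → b ∈ D → ∀ {a′ b′} →
      a′ ≡ a ⊎ b′ ≡ b → tag a′ b′ ≡ 2F → a′ ≡ privateNbr b × b′ ≡ b
    private-edge-unique ab b∈D (inj₁ refl) tag≡2
      with b′∈D , refl ← tag≡2⇒private tag≡2
      with refl ← proj₂ (proj₂ (privateNbr-spec b′∈D)) _ b∈D ab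
      = refl , refl
    private-edge-unique ab b∈D (inj₂ refl) tag≡2 = sym (proj₂ (tag≡2⇒private tag≡2)) , refl

    dominator-edge-unique : ∀ {a b} → b ∉ D → ∀ {a′ b′} → Left a′ → Adj H a′ b′ →
      a′ ≡ a ⊎ b′ ≡ b → tag a′ b′ ≡ tag a (dominator a) → a′ ≡ a × b′ ≡ dominator a
    dominator-edge-unique {a} b∉D a′∈L a′b′ near tag≡
      with refl ← tag≢0⇒dominator a′∈L a′b′ (λ tag≡0 → tag-dominator≢0 a (trans (sym tag≡) tag≡0))
      with near
    ... | inj₁ refl = refl , refl
    ... | inj₂ refl = contradiction (proj₁ (dominator-spec a′∈L a′b′)) b∉D

    colour : Fin n → Fin n → Fin 3
    colour x y with left? x
    ... | yes _ = tag x y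
    ... | no _  = tag y x

    colour-left : ∀ {a b} → Left a → colour a b ≡ tag a b
    colour-left {a} a∈L with left? a
    ... | yes _  = refl
    ... | no a∉L = contradiction a∈L a∉L

    colour-sym : ∀ x y → Adj H x y → colour x y ≡ colour y x
    colour-sym x y xy with left? x | left? y
    ... | yes x∈L | yes y∈L = contradiction y∈L (left-nbr-right x∈L xy)
    ... | yes _   | no _    = refl
    ... | no _    | yes _   = refl
    ... | no x∉L  | no y∉L  = contradiction (right-nbr-left x∉L xy) y∉L

    incident-oriented : ∀ {a b a′ b′} → Left a → Adj H a b → Left a′ → Adj H a′ b′ →
      IncidentTo H a′ b′ a ⊎ IncidentTo H a′ b′ b → a′ ≡ a ⊎ b′ ≡ b
    incident-oriented _   _  _    _    (inj₁ (inj₁ a′≡a))  = inj₁ a′≡a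
    incident-oriented a∈L _  a′∈L a′b′ (inj₁ (inj₂ refl)) = contradiction a∈L (left-nbr-right a′∈L a′b′)
    incident-oriented a∈L ab a′∈L _    (inj₂ (inj₁ refl)) = contradiction a′∈L (left-nbr-right a∈L ab)
    incident-oriented _   _  _    _    (inj₂ (inj₂ b′≡b))  = inj₂ b′≡b

    colour-unique : ∀ {a b} → Left a → Adj H a b → ∀ {t x y} →
      (∀ {a′ b′} → Left a′ → Adj H a′ b′ → a′ ≡ a ⊎ b′ ≡ b → tag a′ b′ ≡ t → a′ ≡ x × b′ ≡ y) →
      ∀ x′ y′ → InClosedNbhd H a b x′ y′ → colour x′ y′ ≡ t → SameEdge H x y x′ y′
    colour-unique a∈L ab tag-unique x′ y′ (x′y′ , near) colour≡t with left? x′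
    ... | yes x′∈L =
      let x′≡x , y′≡y = tag-unique x′∈L x′y′ (incident-oriented a∈L ab x′∈L x′y′ near) colour≡t
      in inj₁ (sym x′≡x , sym y′≡y)
    ... | no x′∉L =
      let y′∈L = right-nbr-left x′∉L x′y′
          y′≡x , x′≡y = tag-unique y′∈L (adj-sym H x′ y′ x′y′)
                          (incident-oriented a∈L ab y′∈L (adj-sym H x′ y′ x′y′) (Sum.map swap swap near))
                          colour≡t
      in inj₂ (sym y′≡x , sym x′≡y)

    colour-cf-left : ∀ {a b} → Left a → Adj H a b → Σ (Fin 3) (UniqueColourAt H colour a b)
    colour-cf-left {a} {b} a∈L ab with b ∈? D
    ... | yes b∈D =
      let s∈L , sb , _ = privateNbr-spec b∈D
      in 2F , privateNbr b , b , (sb , inj₂ (inj₂ refl)) ,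
         trans (colour-left s∈L) (private⇒tag≡2 b∈D) ,
         colour-unique a∈L ab (λ _ _ → private-edge-unique ab b∈D)
    ... | no b∉D =
      tag a (dominator a) , a , dominator a , (proj₂ (dominator-spec a∈L ab) , inj₁ (inj₁ refl)) ,
      colour-left a∈L , colour-unique a∈L ab (dominator-edge-unique b∉D)

    colour-cf : ConflictFree H 3 (colour , colour-sym)
    colour-cf u v uv with left? u
    ... | yes u∈L = colour-cf-left u∈L uv
    ... | no u∉L  = map₂ (uniqueColourAt-swap H) (colour-cf-left (right-nbr-left u∉L uv) (adj-sym H u v uv))

colourable-2⇒cf-3 : ∀ {n} (H : SimpleGraph n) → Colourable H 2 → CFEdgeColourable H 3
colourable-2⇒cf-3 H (side , proper)
  with D , D-dom , D-private ← Bipartite.minimalDominating H side proper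
  = (colour , colour-sym) , colour-cf
  where open Bipartite.Colouring H side proper D D-dom D-private

module Layers {n k} (G : SimpleGraph n) (level : Fin n → Fin n → Maybe (Fin k))
              (level-sym : ∀ x y → level x y ≡ level y x) where

  layer : Fin k → SimpleGraph n
  layer ℓ = record
    { adj    = λ x y → adj G x y ∧ isYes (≡-dec _≟_ (level x y) (just ℓ))
    ; sym    = λ x y xy → let xy′ , xyℓ = Equivalence.to T-∧ xy in
                 Equivalence.from T-∧ (adj-sym G x y xy′ , fromWitness (trans (level-sym y x) (toWitness xyℓ)))
    ; irrefl = λ x xx → irrefl G x (proj₁ (Equivalence.to T-∧ xx))
    }

  layer-adj⁻ : ∀ {ℓ x y} → Adj (layer ℓ) x y → Adj G x y × level x y ≡ just ℓ
  layer-adj⁻ xy = let xy′ , xyℓ = Equivalence.to T-∧ xy in xy′ , toWitness xyℓ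

  layer-adj⁺ : ∀ {ℓ x y} → Adj G x y → level x y ≡ just ℓ → Adj (layer ℓ) x y
  layer-adj⁺ xy xyℓ = Equivalence.from T-∧ (xy , fromWitness xyℓ)

  module _ {m} (layer-cf : ∀ ℓ → CFEdgeColourable (layer ℓ) m)
               (level-edge : ∀ x y → Adj G x y → ∃ λ ℓ → level x y ≡ just ℓ) where

    paint : Fin k → Fin m → Fin (m * k + 1)
    paint ℓ i = combine i ℓ ↑ˡ 1

    paint-injective : ∀ {ℓ i ℓ′ i′} → paint ℓ i ≡ paint ℓ′ i′ → ℓ ≡ ℓ′ × i ≡ i′
    paint-injective {ℓ} {i} {ℓ′} {i′} eq =
      let i≡i′ , ℓ≡ℓ′ = combine-injective i ℓ i′ ℓ′ (↑ˡ-injective 1 _ _ eq) in ℓ≡ℓ′ , i≡i′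

    layer-colour : Fin k → Fin n → Fin n → Fin m
    layer-colour ℓ = proj₁ (proj₁ (layer-cf ℓ))

    -- The extra colour is only a filler for pairs without a level, which are non-edges.
    colour : Fin n → Fin n → Fin (m * k + 1)
    colour x y = maybe′ (λ ℓ → paint ℓ (layer-colour ℓ x y)) ((m * k) ↑ʳ zero) (level x y)

    colour-on-layer : ∀ {ℓ x y} → level x y ≡ just ℓ → colour x y ≡ paint ℓ (layer-colour ℓ x y)
    colour-on-layer {x = x} {y} eq = cong (maybe′ (λ ℓ → paint ℓ (layer-colour ℓ x y)) _) eq

    colour-sym : ∀ x y → Adj G x y → colour x y ≡ colour y x
    colour-sym x y xy with ℓ , xyℓ ← level-edge x y xy = begin
      colour x y                   ≡⟨ colour-on-layer xyℓ ⟩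
      paint ℓ (layer-colour ℓ x y) ≡⟨ cong (paint ℓ) (proj₂ (proj₁ (layer-cf ℓ)) x y (layer-adj⁺ xy xyℓ)) ⟩
      paint ℓ (layer-colour ℓ y x) ≡⟨ colour-on-layer (trans (level-sym y x) xyℓ) ⟨
      colour y x                   ∎
      where open ≡-Reasoning

    colour-cf : ConflictFree G (m * k + 1) (colour , colour-sym)
    colour-cf u v uv
      with ℓ , uvℓ ← level-edge u v uv
      with i , x , y , (xyℓ , near) , xy≡i , unique ← proj₂ (layer-cf ℓ) u v (layer-adj⁺ uv uvℓ)
      = paint ℓ i , x , y , (proj₁ (layer-adj⁻ xyℓ) , near) ,
        trans (colour-on-layer (proj₂ (layer-adj⁻ xyℓ))) (cong (paint ℓ) xy≡i) , unique′
      where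
      unique′ : ∀ x′ y′ → InClosedNbhd G u v x′ y′ → colour x′ y′ ≡ paint ℓ i → SameEdge G x y x′ y′
      unique′ x′ y′ (x′y′ , near′) colour≡
        with ℓ′ , x′y′ℓ′ ← level-edge x′ y′ x′y′
        with refl , x′y′≡i ← paint-injective (trans (sym (colour-on-layer x′y′ℓ′)) colour≡)
        = unique x′ y′ (layer-adj⁺ x′y′ x′y′ℓ′ , near′) x′y′≡i

    layered⇒cf : CFEdgeColourable G (m * k + 1)
    layered⇒cf = (colour , colour-sym) , colour-cf

colourable-mono : ∀ {n} (G : SimpleGraph n) {j k} → j ≤ k → Colourable G j → Colourable G k
colourable-mono G j≤k (f , proper) =
  (λ x → inject≤ (f x) j≤k) , λ x y xy eq → proper x y xy (inject≤-injective j≤k j≤k (f x) (f y) eq)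

colourable-2^k⇒cf-3k+1 : ∀ {n} (G : SimpleGraph n) k → Colourable G (2 ^ k) → CFEdgeColourable G (3 * k + 1)
colourable-2^k⇒cf-3k+1 {n} G k (f , proper) = layered⇒cf layer-cf level-edge
  where
  digits : Fin n → Fin k → Fin 2
  digits x = finToFun (f x)

  level : Fin n → Fin n → Maybe (Fin k)
  level x y = firstDifference _≟_ (digits x) (digits y)

  open Layers G level (λ x y → firstDifference-comm _≟_ (digits x) (digits y))

  layer-cf : ∀ ℓ → CFEdgeColourable (layer ℓ) 3
  layer-cf ℓ = colourable-2⇒cf-3 (layer ℓ) ((λ x → digits x ℓ) , λ x y xy →
    firstDifference≡just⇒≢ _≟_ (digits x) (digits y) (proj₂ (layer-adj⁻ xy)))

  level-edge : ∀ x y → Adj G x y → ∃ λ ℓ → level x y ≡ just ℓ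
  level-edge x y xy with level x y in eq
  ... | just ℓ  = ℓ , refl
  ... | nothing = contradiction (finToFun-injective (firstDifference≡nothing⇒≗ _≟_ _ _ eq)) (proper x y xy)

-- Isolated vertices are harmless: the conflict-free condition only concerns edges.
corollary2 : (n : ℕ) (G : SimpleGraph n) → NoIsolatedVertices G →
    (χ : ℕ) → IsChromaticNumber G χ →
    CFEdgeColourable G (3 * ⌈log₂ χ ⌉ + 1)
corollary2 n G _ χ (χ-colourable , _) =
  colourable-2^k⇒cf-3k+1 G ⌈log₂ χ ⌉ (colourable-mono G (n≤2^⌈log₂n⌉ χ) χ-colourable)
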